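{- The order of promotion on increasing labelings of $\mathcal{Z}_5$ with labels in $[q]$ for $q \geq 5$ is $120q$.
   Context: $\mathcal{Z}_5$ is the zig-zag poset $x_1\lessdot x_2\gtrdot x_3\lessdot x_4\gtrdot x_5$. Increasing labelings are $f:\mathcal{Z}_5\to[q]$ with $f(x)<f(y)$ whenever $x<y$. Promotion: replace labels $1$ by empty boxes; for $i=2,\dots,q$ slide boxes upward (a box at $x$ becomes $i$ if some $y\gtrdot x$ is labeled $i$, and that element becomes a box); replace boxes by $q+1$ and subtract $1$ from all labels. The order is the least $N$ with $\mathrm{Pro}^N$ the identity. -}

module Defs where

open import Data.Nat using (ℕ; zero; suc; _≤_; _<_; _∸_; _≡ᵇ_)
open import Data.Fin using (Fin; zero; suc)
open import Data.Bool using (Bool; true; false; if_then_else_; _∧_)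
open import Data.Maybe using (Maybe; just; nothing)
open import Data.List using (List; []; _∷_)
open import Data.Bool.ListAction using (any)
open import Data.Vec using (Vec; lookup; tabulate)
open import Data.Product using (_×_)

-- Elements x₁,…,x₅ of the zig-zag poset 𝒵₅ are encoded as 0,…,4 : Fin 5.
-- Strict order of 𝒵₅:  x₁ ⋖ x₂ ⋗ x₃ ⋖ x₄ ⋗ x₅.  (In 𝒵₅ every strict
-- relation is a cover relation, so this is exactly the strict order <.)
data _≺_ : Fin 5 → Fin 5 → Set where
  x1<x2 : zero ≺ suc zero
  x3<x2 : suc (suc zero) ≺ suc zero
  x3<x4 : suc (suc zero) ≺ suc (suc (suc zero))
  x5<x4 : suc (suc (suc (suc zero))) ≺ suc (suc (suc zero))

upCovers : Fin 5 → List (Fin 5)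
upCovers zero = suc zero ∷ []
upCovers (suc zero) = []
upCovers (suc (suc zero)) = suc zero ∷ suc (suc (suc zero)) ∷ []
upCovers (suc (suc (suc zero))) = []
upCovers (suc (suc (suc (suc zero)))) = suc (suc (suc zero)) ∷ []

downCovers : Fin 5 → List (Fin 5)
downCovers zero = []
downCovers (suc zero) = zero ∷ suc (suc zero) ∷ []
downCovers (suc (suc zero)) = []
downCovers (suc (suc (suc zero))) = suc (suc zero) ∷ suc (suc (suc (suc zero))) ∷ []
downCovers (suc (suc (suc (suc zero)))) = []

-- A labeling is a vector of 5 labels (label of x_{i+1} at position i).
Labeling : Set
Labeling = Vec ℕ 5

IncLab : ℕ → Labeling → Set
IncLab q f = (∀ x → 1 ≤ lookup f x × lookup f x ≤ q)
           × (∀ x y → x ≺ y → lookup f x < lookup f y)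

-- Intermediate state: nothing = empty box, just i = label i.
State : Set
State = Fin 5 → Maybe ℕ

isLabel : ℕ → Maybe ℕ → Bool
isLabel i (just j) = j ≡ᵇ i
isLabel i nothing = false

isBox : Maybe ℕ → Bool
isBox nothing = true
isBox (just _) = false

slideStep : ℕ → State → State
slideStep i s x with s x
... | nothing = if any (λ y → isLabel i (s y)) (upCovers x) then just i else nothing
... | just j = if (j ≡ᵇ i) ∧ any (λ z → isBox (s z)) (downCovers x) then nothing else just j

slides : ℕ → State → State
slides zero s = s
slides (suc zero) s = s
slides (suc (suc n)) s = slideStep (suc (suc n)) (slides (suc n) s)

pro : ℕ → Labeling → Labeling
pro q f = tabulate (λ x → finish (slides q start x))
  where
  start : State
  start x = if lookup f x ≡ᵇ 1 then nothing else just (lookup f x)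
  finish : Maybe ℕ → ℕ
  finish nothing = q            -- box ↦ q+1, then subtract 1
  finish (just j) = j ∸ 1

iter : {A : Set} → (A → A) → ℕ → A → A
iter g zero a = a
iter g (suc n) a = g (iter g n a)

IsPromotionOrder : ℕ → ℕ → Set
IsPromotionOrder q N =
  1 ≤ N
  × (∀ f → IncLab q f → iter (pro q) N f ≡ f)
  × (∀ M → 1 ≤ M → M < N → Σ Labeling (λ f → IncLab q f × ¬ (iter (pro q) M f ≡ f)))
  where
  open import Relation.Binary.PropositionalEquality using (_≡_)
  open import Relation.Nullary using (¬_)
  open import Data.Product using (Σ)

-- Promotion has a closed form, pro′.  If a labeling in [q + 1] misses the label u, deleting u
-- (lowering every label above it) turns q + 1 promotion steps in [q + 1] into q steps in [q]:
-- the missing label moves down by one per step, and once it is 1 promotion just decrements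
-- every label.  Five elements miss one of the labels 1, …, 6, so Pro^(120 q) = id follows by
-- induction from q = 5, where it is a finite computation.  Conversely, (1,2,1,2,1) has orbit
-- length exactly q, so Pro^M = id forces M = j q; deleting labels then shows that three
-- labelings with orbit lengths 40, 12 and 25 for q = 5 are fixed by Pro^(5 j) there, so
-- 600 ∣ 5 j and M ≥ 120 q.

module Submission where

open import Defs
open import Data.Bool using (Bool; true; false; if_then_else_; _∧_; _∨_; not; T)
open import Data.Bool.Properties using (∧-zeroʳ; ∧-identityʳ; ∨-identityʳ; ∨-zeroʳ; ∨-comm)
open import Data.Empty using (⊥-elim)
open import Data.Fin using (Fin; zero; suc; toℕ)
open import Data.Fin.Properties using (¬∀⟶∃¬; pigeonhole; any?; toℕ<n)
open import Data.Maybe using (Maybe; just; nothing)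
open import Data.Nat
open import Data.Nat.Divisibility using (_∣_; divides; m%n≡0⇒n∣m; ∣⇒≤; *-cancelʳ-∣; *-monoˡ-∣)
open import Data.Nat.DivMod using (_%_; _/_; m≡m%n+[m/n]*n; m%n<n)
open import Data.Nat.LCM using (lcm; lcm-least)
open import Data.Nat.Properties
open import Data.Product using (Σ; ∃-syntax; _×_; _,_; proj₁; proj₂)
open import Data.Sum using (_⊎_; inj₁; inj₂; [_,_]′)
open import Data.Unit using (tt)
open import Data.Vec using (Vec; []; _∷_; lookup; map)
open import Data.Vec.Properties using (lookup-map; ≡-dec)
open import Data.Vec.Relation.Binary.Pointwise.Extensional using (ext; Pointwise-≡⇒≡)
open import Function using (_∘_; _⇔_; mk⇔; Equivalence)
import Function.Properties.Equivalence as ⇔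
open import Function.Strict using (force; force-≡)
open import Relation.Binary.Definitions using (tri<; tri≈; tri>)
open import Relation.Binary.PropositionalEquality
open import Relation.Nullary using (¬_; contradiction; Dec; isYes)
open import Relation.Nullary.Decidable using (True; toWitness; toWitnessFalse; T?; yes; map′; _×-dec_; _⊎-dec_)
open import Relation.Nullary.Reflects using (Reflects; ofʸ; ofⁿ; fromEquivalence; det)

pattern x₁ = zero
pattern x₂ = suc zero
pattern x₃ = suc (suc zero)
pattern x₄ = suc (suc (suc zero))
pattern x₅ = suc (suc (suc (suc zero)))

≡ᵇ-reflects-≡ : ∀ m n → Reflects (m ≡ n) (m ≡ᵇ n)
≡ᵇ-reflects-≡ m n = fromEquivalence (≡ᵇ⇒≡ m n) (≡⇒≡ᵇ m n)

≤⇒≤ᵇ≡true : ∀ {m n} → m ≤ n → (m ≤ᵇ n) ≡ true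
≤⇒≤ᵇ≡true {m} {n} m≤n = det (≤ᵇ-reflects-≤ m n) (ofʸ m≤n)

≰⇒≤ᵇ≡false : ∀ {m n} → ¬ m ≤ n → (m ≤ᵇ n) ≡ false
≰⇒≤ᵇ≡false {m} {n} m≰n = det (≤ᵇ-reflects-≤ m n) (ofⁿ m≰n)

≢⇒≡ᵇ≡false : ∀ {m n} → m ≢ n → (m ≡ᵇ n) ≡ false
≢⇒≡ᵇ≡false {m} {n} m≢n = det (≡ᵇ-reflects-≡ m n) (ofⁿ m≢n)

<⇒≤∸1 : ∀ {m n} → m < n → m ≤ n ∸ 1
<⇒≤∸1 (s≤s m≤n) = m≤n

∸1-mono-< : ∀ {m n} → 1 ≤ m → m < n → m ∸ 1 < n ∸ 1
∸1-mono-< 1≤m m<n = ∸-monoˡ-< m<n 1≤m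

≤-literal : ∀ {m n} {_ : T (m ≤ᵇ n)} → m ≤ n
≤-literal {m} {n} {m≤ᵇn} = ≤ᵇ⇒≤ m n m≤ᵇn

∷₅-cong : ∀ {a b c d e a′ b′ c′ d′ e′ : ℕ} → a ≡ a′ → b ≡ b′ → c ≡ c′ → d ≡ d′ → e ≡ e′ →
          (a ∷ b ∷ c ∷ d ∷ e ∷ []) ≡ (a′ ∷ b′ ∷ c′ ∷ d′ ∷ e′ ∷ [])
∷₅-cong refl refl refl refl refl = refl

record ZigZag (q a b c d e : ℕ) : Set where
  constructor zigzag
  field
    1≤a : 1 ≤ a
    1≤c : 1 ≤ c
    1≤e : 1 ≤ e
    a<b : a < b
    c<b : c < b
    c<d : c < d
    e<d : e < d
    b≤q : b ≤ q
    d≤q : d ≤ q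

  2≤b : 2 ≤ b
  2≤b = ≤-<-trans 1≤a a<b

  2≤d : 2 ≤ d
  2≤d = ≤-<-trans 1≤e e<d

Increasing : ℕ → Labeling → Set
Increasing q (a ∷ b ∷ c ∷ d ∷ e ∷ []) = ZigZag q a b c d e

increasing-mono : ∀ {m q v} → m ≤ q → Increasing m v → Increasing q v
increasing-mono {v = a ∷ b ∷ c ∷ d ∷ e ∷ []} m≤q zz =
  zigzag 1≤a 1≤c 1≤e a<b c<b c<d e<d (≤-trans b≤q m≤q) (≤-trans d≤q m≤q)
  where open ZigZag zz

labels-bounded : ∀ {q v} → Increasing q v → ∀ x → 1 ≤ lookup v x × lookup v x ≤ q
labels-bounded {v = a ∷ b ∷ c ∷ d ∷ e ∷ []} zz = λ where
    x₁ → 1≤a , ≤-trans (<⇒≤ a<b) b≤q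
    x₂ → ≤-trans 1≤a (<⇒≤ a<b) , b≤q
    x₃ → 1≤c , ≤-trans (<⇒≤ c<b) b≤q
    x₄ → ≤-trans 1≤e (<⇒≤ e<d) , d≤q
    x₅ → 1≤e , ≤-trans (<⇒≤ e<d) d≤q
  where open ZigZag zz

IncLab⇒Increasing : ∀ {q v} → IncLab q v → Increasing q v
IncLab⇒Increasing {v = a ∷ b ∷ c ∷ d ∷ e ∷ []} (bounded , ordered) = zigzag
  (proj₁ (bounded x₁)) (proj₁ (bounded x₃)) (proj₁ (bounded x₅))
  (ordered x₁ x₂ x1<x2) (ordered x₃ x₂ x3<x2) (ordered x₃ x₄ x3<x4) (ordered x₅ x₄ x5<x4)
  (proj₂ (bounded x₂)) (proj₂ (bounded x₄))

Increasing⇒IncLab : ∀ {q v} → Increasing q v → IncLab q v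
Increasing⇒IncLab {v = a ∷ b ∷ c ∷ d ∷ e ∷ []} zz = labels-bounded zz , λ where
    _ _ x1<x2 → a<b
    _ _ x3<x2 → c<b
    _ _ x3<x4 → c<d
    _ _ x5<x4 → e<d
  where open ZigZag zz

-- Promotion in closed form

-- A minimal element labelled 1 receives the label of its lowest upper cover, any other
-- minimal element is decremented, and a peak becomes q exactly when the box climbs into it:
-- its private lower cover is labelled 1, or the shared one is and it is the lower peak.
boxEnters : ℕ → ℕ → ℕ → ℕ → Bool
boxEnters a b c d = (a ≡ᵇ 1) ∨ ((c ≡ᵇ 1) ∧ (b ≤ᵇ d))

proMin : ℕ → ℕ → ℕ
proMin v w = if v ≡ᵇ 1 then w ∸ 1 else v ∸ 1

proMax : ℕ → ℕ → ℕ → ℕ → ℕ → ℕ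
proMax q a b c d = if boxEnters a b c d then q else b ∸ 1

pro′ : ℕ → Labeling → Labeling
pro′ q (a ∷ b ∷ c ∷ d ∷ e ∷ []) =
  proMin a b ∷ proMax q a b c d ∷ proMin c (b ⊓ d) ∷ proMax q e d c b ∷ proMin e d ∷ []

slideMin : ℕ → Maybe ℕ → Bool → Maybe ℕ
slideMin i nothing  labelAbove = if labelAbove then just i else nothing
slideMin i (just j) _          = just j

slideMax : ℕ → Maybe ℕ → Bool → Maybe ℕ
slideMax i nothing  _        = nothing
slideMax i (just j) boxBelow = if (j ≡ᵇ i) ∧ boxBelow then nothing else just j

module _ {i : ℕ} {s : State} where

  slideStep-x₁ : slideStep i s x₁ ≡ slideMin i (s x₁) (isLabel i (s x₂))
  slideStep-x₁ with s x₁
  ... | nothing = cong (λ t → if t then just i else nothing) (∨-identityʳ _)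
  ... | just j  = cong (λ t → if t then nothing else just j) (∧-zeroʳ _)

  slideStep-x₂ : slideStep i s x₂ ≡ slideMax i (s x₂) (isBox (s x₁) ∨ isBox (s x₃))
  slideStep-x₂ with s x₂
  ... | nothing = refl
  ... | just j  = cong (λ t → if (j ≡ᵇ i) ∧ (isBox (s x₁) ∨ t) then nothing else just j) (∨-identityʳ _)

  slideStep-x₃ : slideStep i s x₃ ≡ slideMin i (s x₃) (isLabel i (s x₂) ∨ isLabel i (s x₄))
  slideStep-x₃ with s x₃
  ... | nothing = cong (λ t → if isLabel i (s x₂) ∨ t then just i else nothing) (∨-identityʳ _)
  ... | just j  = cong (λ t → if t then nothing else just j) (∧-zeroʳ _)

  slideStep-x₄ : slideStep i s x₄ ≡ slideMax i (s x₄) (isBox (s x₃) ∨ isBox (s x₅))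
  slideStep-x₄ with s x₄
  ... | nothing = refl
  ... | just j  = cong (λ t → if (j ≡ᵇ i) ∧ (isBox (s x₃) ∨ t) then nothing else just j) (∨-identityʳ _)

  slideStep-x₅ : slideStep i s x₅ ≡ slideMin i (s x₅) (isLabel i (s x₄))
  slideStep-x₅ with s x₅
  ... | nothing = cong (λ t → if t then just i else nothing) (∨-identityʳ _)
  ... | just j  = cong (λ t → if t then nothing else just j) (∧-zeroʳ _)

minimalAfter : ℕ → ℕ → ℕ → Maybe ℕ
minimalAfter n v w = if v ≡ᵇ 1 then (if w ≤ᵇ n then just w else nothing) else just v

maximalAfter : ℕ → Bool → ℕ → Maybe ℕ
maximalAfter n entered w = if entered ∧ (w ≤ᵇ n) then nothing else just w

-- The state after sliding the labels 2, …, n: a box stays on its minimal element until step w,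
-- w the label of its lowest upper cover, and from then on sits on that peak.
slid : ℕ → Labeling → State
slid n (a ∷ b ∷ c ∷ d ∷ e ∷ []) x₁ = minimalAfter n a b
slid n (a ∷ b ∷ c ∷ d ∷ e ∷ []) x₂ = maximalAfter n (boxEnters a b c d) b
slid n (a ∷ b ∷ c ∷ d ∷ e ∷ []) x₃ = minimalAfter n c (b ⊓ d)
slid n (a ∷ b ∷ c ∷ d ∷ e ∷ []) x₄ = maximalAfter n (boxEnters e d c b) d
slid n (a ∷ b ∷ c ∷ d ∷ e ∷ []) x₅ = minimalAfter n e d

slideMin-minimalAfter : ∀ {n} v w {labelAbove} → (n < w → labelAbove ≡ (w ≡ᵇ suc n)) →
                        slideMin (suc n) (minimalAfter n v w) labelAbove ≡ minimalAfter (suc n) v w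
slideMin-minimalAfter {n} v w labelAbove≡ with v ≡ᵇ 1
... | false = refl
... | true with w ≤ᵇ n | ≤ᵇ-reflects-≤ w n
...   | true  | ofʸ w≤n rewrite ≤⇒≤ᵇ≡true (m≤n⇒m≤1+n w≤n) = refl
...   | false | ofⁿ w≰n rewrite labelAbove≡ (≰⇒> w≰n) with w ≡ᵇ suc n | ≡ᵇ-reflects-≡ w (suc n)
...     | true  | ofʸ refl rewrite ≤⇒≤ᵇ≡true (≤-refl {suc n}) = refl
...     | false | ofⁿ w≢1+n rewrite ≰⇒≤ᵇ≡false (<⇒≱ (≤∧≢⇒< (≰⇒> w≰n) (w≢1+n ∘ sym))) = refl

slideMax-maximalAfter : ∀ {n} entered w {boxBelow} → (w ≡ suc n → boxBelow ≡ entered) →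
                        slideMax (suc n) (maximalAfter n entered w) boxBelow ≡ maximalAfter (suc n) entered w
slideMax-maximalAfter {n} false w boxBelow≡ with w ≡ᵇ suc n | ≡ᵇ-reflects-≡ w (suc n)
... | true  | ofʸ w≡1+n rewrite boxBelow≡ w≡1+n = refl
... | false | _ = refl
slideMax-maximalAfter {n} true w boxBelow≡ with w ≤ᵇ n | ≤ᵇ-reflects-≤ w n
... | true  | ofʸ w≤n rewrite ≤⇒≤ᵇ≡true (m≤n⇒m≤1+n w≤n) = refl
... | false | ofⁿ w≰n with w ≡ᵇ suc n | ≡ᵇ-reflects-≡ w (suc n)
...   | true  | ofʸ refl rewrite boxBelow≡ refl | ≤⇒≤ᵇ≡true (≤-refl {suc n}) = refl
...   | false | ofⁿ w≢1+n rewrite ≰⇒≤ᵇ≡false (<⇒≱ (≤∧≢⇒< (≰⇒> w≰n) (w≢1+n ∘ sym))) = refl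

isLabel-maximalAfter : ∀ {i n} entered {w} → n < w → isLabel i (maximalAfter n entered w) ≡ (w ≡ᵇ i)
isLabel-maximalAfter entered n<w rewrite ≰⇒≤ᵇ≡false (<⇒≱ n<w) | ∧-zeroʳ entered = refl

isBox-minimalAfter : ∀ {n} v {w} → n < w → isBox (minimalAfter n v w) ≡ (v ≡ᵇ 1)
isBox-minimalAfter v n<w with v ≡ᵇ 1
... | true rewrite ≰⇒≤ᵇ≡false (<⇒≱ n<w) = refl
... | false = refl

isBox-minimalAfter-≤ : ∀ {n} v {w} → w ≤ n → isBox (minimalAfter n v w) ≡ false
isBox-minimalAfter-≤ v w≤n with v ≡ᵇ 1
... | true rewrite ≤⇒≤ᵇ≡true w≤n = refl
... | false = refl

⊓-≡ᵇ-suc : ∀ {n b d} → n < b → n < d → ((b ≡ᵇ suc n) ∨ (d ≡ᵇ suc n)) ≡ (b ⊓ d ≡ᵇ suc n)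
⊓-≡ᵇ-suc {n} {b} {d} n<b n<d with ≤-total b d
... | inj₁ b≤d rewrite m≤n⇒m⊓n≡m b≤d with b ≡ᵇ suc n | ≡ᵇ-reflects-≡ b (suc n)
...   | true  | _ = refl
...   | false | ofⁿ b≢1+n = ≢⇒≡ᵇ≡false {d} λ { refl → b≢1+n (≤-antisym b≤d n<b) }
⊓-≡ᵇ-suc {n} {b} {d} n<b n<d | inj₂ d≤b rewrite m≥n⇒m⊓n≡n d≤b with d ≡ᵇ suc n | ≡ᵇ-reflects-≡ d (suc n)
...   | true  | _ = ∨-zeroʳ _
...   | false | ofⁿ d≢1+n rewrite ≢⇒≡ᵇ≡false {b} {suc n} (λ { refl → d≢1+n (≤-antisym d≤b n<d) }) = refl

isLabel-peaks : ∀ {n} entered₁ entered₂ b d → n < b ⊓ d →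
                (isLabel (suc n) (maximalAfter n entered₁ b) ∨ isLabel (suc n) (maximalAfter n entered₂ d))
                ≡ (b ⊓ d ≡ᵇ suc n)
isLabel-peaks {n} entered₁ entered₂ b d n<b⊓d =
  trans (cong₂ _∨_ (isLabel-maximalAfter entered₁ n<b) (isLabel-maximalAfter entered₂ n<d)) (⊓-≡ᵇ-suc n<b n<d)
  where
  n<b = <-≤-trans n<b⊓d (m⊓n≤m b d)
  n<d = <-≤-trans n<b⊓d (m⊓n≤n b d)

isBox-below : ∀ {n} a b c d → b ≡ suc n →
              (isBox (minimalAfter n a b) ∨ isBox (minimalAfter n c (b ⊓ d))) ≡ boxEnters a b c d
isBox-below {n} a b c d refl rewrite isBox-minimalAfter a (n<1+n n) with suc n ≤ᵇ d | ≤ᵇ-reflects-≤ (suc n) d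
... | true  | ofʸ b≤d rewrite m≤n⇒m⊓n≡m b≤d | isBox-minimalAfter c (n<1+n n) | ∧-identityʳ (c ≡ᵇ 1) = refl
... | false | ofⁿ b≰d rewrite m≥n⇒m⊓n≡n (<⇒≤ (≰⇒> b≰d)) | isBox-minimalAfter-≤ c (≤-pred (≰⇒> b≰d))
                           | ∧-zeroʳ (c ≡ᵇ 1) = refl

slideStep-slid : ∀ {n v} {s : State} → (∀ y → s y ≡ slid n v y) → ∀ x → slideStep (suc n) s x ≡ slid (suc n) v x
slideStep-slid {n} {a ∷ b ∷ c ∷ d ∷ e ∷ []} {s} s≗slid x₁
  rewrite slideStep-x₁ {suc n} {s} | s≗slid x₁ | s≗slid x₂ =
  slideMin-minimalAfter a b (isLabel-maximalAfter (boxEnters a b c d))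
slideStep-slid {n} {a ∷ b ∷ c ∷ d ∷ e ∷ []} {s} s≗slid x₂
  rewrite slideStep-x₂ {suc n} {s} | s≗slid x₁ | s≗slid x₂ | s≗slid x₃ =
  slideMax-maximalAfter (boxEnters a b c d) b (isBox-below a b c d)
slideStep-slid {n} {a ∷ b ∷ c ∷ d ∷ e ∷ []} {s} s≗slid x₃
  rewrite slideStep-x₃ {suc n} {s} | s≗slid x₂ | s≗slid x₃ | s≗slid x₄ =
  slideMin-minimalAfter c (b ⊓ d) (isLabel-peaks (boxEnters a b c d) (boxEnters e d c b) b d)
slideStep-slid {n} {a ∷ b ∷ c ∷ d ∷ e ∷ []} {s} s≗slid x₄
  rewrite slideStep-x₄ {suc n} {s} | s≗slid x₃ | s≗slid x₄ | s≗slid x₅ | ⊓-comm b d =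
  slideMax-maximalAfter (boxEnters e d c b) d
    (λ d≡1+n → trans (∨-comm (isBox (minimalAfter n c (d ⊓ b))) _) (isBox-below e d c b d≡1+n))
slideStep-slid {n} {a ∷ b ∷ c ∷ d ∷ e ∷ []} {s} s≗slid x₅
  rewrite slideStep-x₅ {suc n} {s} | s≗slid x₄ | s≗slid x₅ =
  slideMin-minimalAfter e d (isLabel-maximalAfter (boxEnters e d c b))

slides-slid : ∀ {v} {s : State} → (∀ y → s y ≡ slid 1 v y) → ∀ n x → slides (suc n) s x ≡ slid (suc n) v x
slides-slid         s≗slid zero    = s≗slid
slides-slid {v} {s} s≗slid (suc n) = slideStep-slid {v = v} (slides-slid {v} {s} s≗slid n)

initial : Labeling → State
initial v x = if lookup v x ≡ᵇ 1 then nothing else just (lookup v x)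

initial-slid : ∀ {q v} → Increasing q v → ∀ x → initial v x ≡ slid 1 v x
initial-slid {v = a ∷ b ∷ c ∷ d ∷ e ∷ []} inc x₁ rewrite ≰⇒≤ᵇ≡false (<⇒≱ (ZigZag.2≤b inc)) = refl
initial-slid {v = a ∷ b ∷ c ∷ d ∷ e ∷ []} inc x₂
  rewrite ≰⇒≤ᵇ≡false (<⇒≱ (ZigZag.2≤b inc)) | ≢⇒≡ᵇ≡false (>⇒≢ (ZigZag.2≤b inc)) | ∧-zeroʳ (boxEnters a b c d) = refl
initial-slid {v = a ∷ b ∷ c ∷ d ∷ e ∷ []} inc x₃
  rewrite ≰⇒≤ᵇ≡false (<⇒≱ (⊓-glb (ZigZag.2≤b inc) (ZigZag.2≤d inc))) = refl
initial-slid {v = a ∷ b ∷ c ∷ d ∷ e ∷ []} inc x₄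
  rewrite ≰⇒≤ᵇ≡false (<⇒≱ (ZigZag.2≤d inc)) | ≢⇒≡ᵇ≡false (>⇒≢ (ZigZag.2≤d inc)) | ∧-zeroʳ (boxEnters e d c b) = refl
initial-slid {v = a ∷ b ∷ c ∷ d ∷ e ∷ []} inc x₅ rewrite ≰⇒≤ᵇ≡false (<⇒≱ (ZigZag.2≤d inc)) = refl

finishLabel : ℕ → Maybe ℕ → ℕ
finishLabel q nothing  = q
finishLabel q (just j) = j ∸ 1

finishLabel-minimalAfter : ∀ {q} v {w} → w ≤ q → finishLabel q (minimalAfter q v w) ≡ proMin v w
finishLabel-minimalAfter v w≤q with v ≡ᵇ 1
... | true rewrite ≤⇒≤ᵇ≡true w≤q = refl
... | false = refl

finishLabel-maximalAfter : ∀ {q} entered {w} → w ≤ q →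
                           finishLabel q (maximalAfter q entered w) ≡ (if entered then q else w ∸ 1)
finishLabel-maximalAfter true  w≤q rewrite ≤⇒≤ᵇ≡true w≤q = refl
finishLabel-maximalAfter false w≤q = refl

finishLabel-slid : ∀ {q v} → Increasing q v → ∀ x → finishLabel q (slid q v x) ≡ lookup (pro′ q v) x
finishLabel-slid {v = a ∷ b ∷ c ∷ d ∷ e ∷ []} inc x₁ = finishLabel-minimalAfter a (ZigZag.b≤q inc)
finishLabel-slid {v = a ∷ b ∷ c ∷ d ∷ e ∷ []} inc x₂ = finishLabel-maximalAfter (boxEnters a b c d) (ZigZag.b≤q inc)
finishLabel-slid {v = a ∷ b ∷ c ∷ d ∷ e ∷ []} inc x₃ = finishLabel-minimalAfter c (≤-trans (m⊓n≤m b d) (ZigZag.b≤q inc))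
finishLabel-slid {v = a ∷ b ∷ c ∷ d ∷ e ∷ []} inc x₄ = finishLabel-maximalAfter (boxEnters e d c b) (ZigZag.d≤q inc)
finishLabel-slid {v = a ∷ b ∷ c ∷ d ∷ e ∷ []} inc x₅ = finishLabel-minimalAfter e (ZigZag.d≤q inc)

pro≡pro′ : ∀ {q v} → Increasing q v → pro q v ≡ pro′ q v
pro≡pro′ {zero} {a ∷ b ∷ c ∷ d ∷ e ∷ []} inc = ⊥-elim (<⇒≱ (ZigZag.2≤b inc) (≤-trans (ZigZag.b≤q inc) z≤n))
pro≡pro′ {suc n} {v} inc = Pointwise-≡⇒≡ (ext at)
  where
  finished : ∀ x {m} → m ≡ slid (suc n) v x → finishLabel (suc n) m ≡ lookup (pro′ (suc n) v) x
  finished x refl = finishLabel-slid inc x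

  slid-now : ∀ x → slides (suc n) (initial v) x ≡ slid (suc n) v x
  slid-now = slides-slid {v} (initial-slid inc) n

  -- `pro` ends with a local copy of `finishLabel`, which only computes on `nothing` and `just`.
  at : ∀ x → lookup (pro (suc n) v) x ≡ lookup (pro′ (suc n) v) x
  at x₁ with slides (suc n) (initial v) x₁ | slid-now x₁
  ... | nothing | eq = finished x₁ eq
  ... | just _  | eq = finished x₁ eq
  at x₂ with slides (suc n) (initial v) x₂ | slid-now x₂
  ... | nothing | eq = finished x₂ eq
  ... | just _  | eq = finished x₂ eq
  at x₃ with slides (suc n) (initial v) x₃ | slid-now x₃
  ... | nothing | eq = finished x₃ eq
  ... | just _  | eq = finished x₃ eq
  at x₄ with slides (suc n) (initial v) x₄ | slid-now x₄
  ... | nothing | eq = finished x₄ eq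
  ... | just _  | eq = finished x₄ eq
  at x₅ with slides (suc n) (initial v) x₅ | slid-now x₅
  ... | nothing | eq = finished x₅ eq
  ... | just _  | eq = finished x₅ eq

proMin-≢1 : ∀ {v} w → v ≢ 1 → proMin v w ≡ v ∸ 1
proMin-≢1 w v≢1 rewrite ≢⇒≡ᵇ≡false v≢1 = refl

proMin-≤ : ∀ v w → v < w → proMin v w ≤ w ∸ 1
proMin-≤ v w v<w with v ≡ᵇ 1
... | true  = ≤-refl
... | false = ∸-monoˡ-≤ 1 (<⇒≤ v<w)

proMin-positive : ∀ {v w} → 1 ≤ v → v < w → 1 ≤ proMin v w
proMin-positive {v} 1≤v v<w with v ≡ᵇ 1 | ≡ᵇ-reflects-≡ v 1
... | true  | _        = <⇒≤∸1 (≤-<-trans 1≤v v<w)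
... | false | ofⁿ v≢1 = <⇒≤∸1 (≤∧≢⇒< 1≤v (v≢1 ∘ sym))

proMin<q : ∀ {v w q} → 1 ≤ v → v < w → w ≤ q → proMin v w < q
proMin<q {v} {suc w} 1≤v v<w w≤q = ≤-<-trans (proMin-≤ v (suc w) v<w) w≤q

<proMax : ∀ {x q} a b c d → x < q → (boxEnters a b c d ≡ false → x < b ∸ 1) → x < proMax q a b c d
<proMax a b c d x<q x<b∸1 with boxEnters a b c d
... | true  = x<q
... | false = x<b∸1 refl

boxEnters-false : ∀ a b c d → boxEnters a b c d ≡ false → a ≢ 1 × (c ≡ 1 → d < b)
boxEnters-false a b c d with a ≡ᵇ 1 | ≡ᵇ-reflects-≡ a 1 | c ≡ᵇ 1 | ≡ᵇ-reflects-≡ c 1 | b ≤ᵇ d | ≤ᵇ-reflects-≤ b d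
... | true  | _        | _     | _        | _     | _        = λ ()
... | false | ofⁿ a≢1 | false | ofⁿ c≢1 | _     | _        = λ _ → a≢1 , ⊥-elim ∘ c≢1
... | false | ofⁿ a≢1 | true  | _        | true  | _        = λ ()
... | false | ofⁿ a≢1 | true  | _        | false | ofⁿ b≰d = λ _ → a≢1 , λ _ → ≰⇒> b≰d

proMax≤q : ∀ {q} a b c d → b ≤ q → proMax q a b c d ≤ q
proMax≤q a b c d b≤q with boxEnters a b c d
... | true  = ≤-refl
... | false = ≤-trans (m∸n≤m b 1) b≤q

proMin<proMax : ∀ {q} a b c d → 1 ≤ a → a < b → b ≤ q → proMin a b < proMax q a b c d
proMin<proMax a b c d 1≤a a<b b≤q = <proMax a b c d (proMin<q 1≤a a<b b≤q) λ notEnters →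
  subst (_< b ∸ 1) (sym (proMin-≢1 b (proj₁ (boxEnters-false a b c d notEnters)))) (∸1-mono-< 1≤a a<b)

proMid<proMax : ∀ {q} a b c d → 1 ≤ c → c < b → c < d → b ≤ q → proMin c (b ⊓ d) < proMax q a b c d
proMid<proMax a b c d 1≤c c<b c<d b≤q =
  <proMax a b c d (proMin<q 1≤c (⊓-glb c<b c<d) (≤-trans (m⊓n≤m b d) b≤q))
    (mid<b∸1 ∘ proj₂ ∘ boxEnters-false a b c d)
  where
  mid<b∸1 : (c ≡ 1 → d < b) → proMin c (b ⊓ d) < b ∸ 1
  mid<b∸1 d<b with c ≡ᵇ 1 | ≡ᵇ-reflects-≡ c 1
  ... | true  | ofʸ c≡1 rewrite m≥n⇒m⊓n≡n (<⇒≤ (d<b c≡1)) = ∸1-mono-< (≤-trans 1≤c (<⇒≤ c<d)) (d<b c≡1)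
  ... | false | _        = ∸1-mono-< 1≤c c<b

pro′-increasing : ∀ {q v} → Increasing q v → Increasing q (pro′ q v)
pro′-increasing {q} {a ∷ b ∷ c ∷ d ∷ e ∷ []} zz = record
  { 1≤a = proMin-positive 1≤a a<b
  ; 1≤c = proMin-positive 1≤c (⊓-glb c<b c<d)
  ; 1≤e = proMin-positive 1≤e e<d
  ; a<b = proMin<proMax a b c d 1≤a a<b b≤q
  ; c<b = proMid<proMax a b c d 1≤c c<b c<d b≤q
  ; c<d = subst (λ m → proMin c m < proMax q e d c b) (⊓-comm d b) (proMid<proMax e d c b 1≤c c<d c<b d≤q)
  ; e<d = proMin<proMax e d c b 1≤e e<d d≤q
  ; b≤q = proMax≤q a b c d b≤q
  ; d≤q = proMax≤q e d c b d≤q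
  }
  where open ZigZag zz

iter-+ : ∀ {A : Set} (f : A → A) m n x → iter f (m + n) x ≡ iter f m (iter f n x)
iter-+ f zero    n x = refl
iter-+ f (suc m) n x = cong f (iter-+ f m n x)

iter-suc : ∀ {A : Set} (f : A → A) n x → iter f n (f x) ≡ iter f (suc n) x
iter-suc f zero    x = refl
iter-suc f (suc n) x = cong f (iter-suc f n x)

iter-* : ∀ {A : Set} (f : A → A) {n x} → iter f n x ≡ x → ∀ k → iter f (k * n) x ≡ x
iter-* f         fixed zero    = refl
iter-* f {n} {x} fixed (suc k) = trans (iter-+ f n (k * n) x) (trans (cong (iter f n) (iter-* f fixed k)) fixed)

iter-% : ∀ {A : Set} (f : A → A) {n x} .{{_ : NonZero n}} → iter f n x ≡ x → ∀ m → iter f (m % n) x ≡ iter f m x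
iter-% f {n} {x} fixed m = begin
  iter f (m % n) x                      ≡⟨ cong (iter f (m % n)) (sym (iter-* f fixed (m / n))) ⟩
  iter f (m % n) (iter f (m / n * n) x) ≡⟨ sym (iter-+ f (m % n) (m / n * n) x) ⟩
  iter f (m % n + m / n * n) x          ≡⟨ cong (λ k → iter f k x) (sym (m≡m%n+[m/n]*n m n)) ⟩
  iter f m x                            ∎
  where open ≡-Reasoning

period-∣ : ∀ {A : Set} (f : A → A) {d x} .{{_ : NonZero d}} → iter f d x ≡ x →
           (∀ s → 1 ≤ s → s < d → iter f s x ≢ x) → ∀ {m} → iter f m x ≡ x → d ∣ m
period-∣ f {d} fixed moves {m} fixedₘ with m % d in m%d≡r | iter-% f fixed m
... | zero  | _      = m%n≡0⇒n∣m m d m%d≡r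
... | suc r | fixedᵣ = contradiction (trans fixedᵣ fixedₘ) (moves (suc r) (s≤s z≤n) (subst (_< d) m%d≡r (m%n<n m d)))

iter-increasing : ∀ {q v} → Increasing q v → ∀ n → Increasing q (iter (pro′ q) n v)
iter-increasing inc zero    = inc
iter-increasing inc (suc n) = pro′-increasing (iter-increasing inc n)

iter-pro≡iter-pro′ : ∀ {q v} → Increasing q v → ∀ n → iter (pro q) n v ≡ iter (pro′ q) n v
iter-pro≡iter-pro′ inc zero        = refl
iter-pro≡iter-pro′ {q} inc (suc n) = trans (cong (pro q) (iter-pro≡iter-pro′ inc n)) (pro≡pro′ (iter-increasing inc n))

-- Deleting an unused label

compress : ℕ → ℕ → ℕ
compress u x = if u <ᵇ x then x ∸ 1 else x

compressLab : ℕ → Labeling → Labeling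
compressLab u = map (compress u)

Avoids : ℕ → Labeling → Set
Avoids u v = ∀ x → lookup v x ≢ u

compress-≤ : ∀ {u x} → x ≤ u → compress u x ≡ x
compress-≤ {u} {x} x≤u rewrite det (<ᵇ-reflects-< u x) (ofⁿ (≤⇒≯ x≤u)) = refl

compress-> : ∀ {u x} → u < x → compress u x ≡ x ∸ 1
compress-> {u} {x} u<x rewrite det (<ᵇ-reflects-< u x) (ofʸ u<x) = refl

compress-pred : ∀ u x → compress u (x ∸ 1) ≡ compress (suc u) x ∸ 1
compress-pred u zero = refl
compress-pred u (suc x) with u <ᵇ x
... | true  = refl
... | false = refl

compress-positive : ∀ {u x} → 1 ≤ u → 1 ≤ x → 1 ≤ compress u x
compress-positive {u} {x} 1≤u 1≤x with u <ᵇ x | <ᵇ-reflects-< u x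
... | true  | ofʸ u<x = <⇒≤∸1 (≤-<-trans 1≤u u<x)
... | false | _       = 1≤x

compress-≤-pred : ∀ {u x p} → u ≤ suc p → x ≤ suc p → x ≢ u → compress u x ≤ p
compress-≤-pred {u} {x} u≤1+p x≤1+p x≢u with u <ᵇ x | <ᵇ-reflects-< u x
... | true  | _        = ∸-monoˡ-≤ 1 x≤1+p
... | false | ofⁿ u≮x = ≤-pred (<-≤-trans (≤∧≢⇒< (≮⇒≥ u≮x) x≢u) u≤1+p)

compress-mono-≤ : ∀ {u x y} → x ≤ y → compress u x ≤ compress u y
compress-mono-≤ {u} {x} {y} x≤y with u <ᵇ x | <ᵇ-reflects-< u x | u <ᵇ y | <ᵇ-reflects-< u y
... | true  | _        | true  | _        = ∸-monoˡ-≤ 1 x≤y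
... | true  | ofʸ u<x  | false | ofⁿ u≮y = contradiction (<-≤-trans u<x x≤y) u≮y
... | false | ofⁿ u≮x | true  | ofʸ u<y = <⇒≤∸1 (≤-<-trans (≮⇒≥ u≮x) u<y)
... | false | _        | false | _        = x≤y

compress-mono-< : ∀ {u x y} → x ≢ u → x < y → compress u x < compress u y
compress-mono-< {u} {x} {y} x≢u x<y with u <ᵇ x | <ᵇ-reflects-< u x | u <ᵇ y | <ᵇ-reflects-< u y
... | true  | ofʸ u<x  | true  | _        = ∸1-mono-< (≤-trans (s≤s z≤n) u<x) x<y
... | true  | ofʸ u<x  | false | ofⁿ u≮y = contradiction (<-trans u<x x<y) u≮y
... | false | ofⁿ u≮x | true  | ofʸ u<y = <-≤-trans (≤∧≢⇒< (≮⇒≥ u≮x) x≢u) (<⇒≤∸1 u<y)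
... | false | _        | false | _        = x<y

compress-injective : ∀ {u x y} → x ≢ u → y ≢ u → compress u x ≡ compress u y → x ≡ y
compress-injective {u} {x} {y} x≢u y≢u eq with <-cmp x y
... | tri< x<y _ _ = contradiction eq (<⇒≢ (compress-mono-< x≢u x<y))
... | tri≈ _ x≡y _ = x≡y
... | tri> _ _ y<x = contradiction eq (>⇒≢ (compress-mono-< y≢u y<x))

compress-⊓ : ∀ u x y → compress u (x ⊓ y) ≡ compress u x ⊓ compress u y
compress-⊓ u = mono-≤-distrib-⊓ (compress-mono-≤ {u})

∸1-≡ᵇ1 : ∀ {x} → 2 < x → (x ∸ 1 ≡ᵇ 1) ≡ (x ≡ᵇ 1)
∸1-≡ᵇ1 {suc (suc (suc _))} _ = refl
∸1-≡ᵇ1 {1} (s≤s ())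
∸1-≡ᵇ1 {2} (s≤s (s≤s ()))

compress-≡ᵇ1 : ∀ {u} → 2 ≤ u → ∀ x → (compress u x ≡ᵇ 1) ≡ (x ≡ᵇ 1)
compress-≡ᵇ1 {u} 2≤u x with u <ᵇ x | <ᵇ-reflects-< u x
... | true  | ofʸ u<x = ∸1-≡ᵇ1 (≤-<-trans 2≤u u<x)
... | false | _       = refl

compress-≤ᵇ : ∀ {u} x {y} → y ≢ u → (compress u x ≤ᵇ compress u y) ≡ (x ≤ᵇ y)
compress-≤ᵇ x {y} y≢u with x ≤ᵇ y | ≤ᵇ-reflects-≤ x y
... | true  | ofʸ x≤y = ≤⇒≤ᵇ≡true (compress-mono-≤ x≤y)
... | false | ofⁿ x≰y = ≰⇒≤ᵇ≡false (<⇒≱ (compress-mono-< y≢u (≰⇒> x≰y)))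

compress-proMin : ∀ {u} → 1 ≤ u → ∀ v w → compress u (proMin v w) ≡ proMin (compress (suc u) v) (compress (suc u) w)
compress-proMin {u} 1≤u v w rewrite compress-≡ᵇ1 (s≤s 1≤u) v with v ≡ᵇ 1
... | true  = compress-pred u w
... | false = compress-pred u v

compress-proMax : ∀ {u p} → 1 ≤ u → u ≤ p → ∀ a b c d → d ≢ suc u →
                  compress u (proMax (suc p) a b c d)
                  ≡ proMax p (compress (suc u) a) (compress (suc u) b) (compress (suc u) c) (compress (suc u) d)
compress-proMax {u} 1≤u u≤p a b c d d≢1+u
  rewrite compress-≡ᵇ1 (s≤s 1≤u) a | compress-≡ᵇ1 (s≤s 1≤u) c | compress-≤ᵇ b d≢1+u
  with boxEnters a b c d
... | true  = compress-> (s≤s u≤p)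
... | false = compress-pred u b

compress-pro′ : ∀ {u p v} → 1 ≤ u → u ≤ p → Avoids (suc u) v →
                compressLab u (pro′ (suc p) v) ≡ pro′ p (compressLab (suc u) v)
compress-pro′ {u} {p} {a ∷ b ∷ c ∷ d ∷ e ∷ []} 1≤u u≤p avoids = ∷₅-cong
  (compress-proMin 1≤u a b)
  (compress-proMax 1≤u u≤p a b c d (avoids x₄))
  (trans (compress-proMin 1≤u c (b ⊓ d)) (cong (proMin (compress (suc u) c)) (compress-⊓ (suc u) b d)))
  (compress-proMax 1≤u u≤p e d c b (avoids x₂))
  (compress-proMin 1≤u e d)

compressLab-injective : ∀ {u v v′} → Avoids u v → Avoids u v′ → compressLab u v ≡ compressLab u v′ → v ≡ v′
compressLab-injective {u} {v} {v′} avoids avoids′ eq = Pointwise-≡⇒≡ (ext λ x →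
  compress-injective (avoids x) (avoids′ x)
    (trans (sym (lookup-map x (compress u) v)) (trans (cong (λ z → lookup z x) eq) (lookup-map x (compress u) v′))))

compressLab-increasing : ∀ {p u v} → 1 ≤ u → u ≤ suc p → Increasing (suc p) v → Avoids u v →
                         Increasing p (compressLab u v)
compressLab-increasing {v = a ∷ b ∷ c ∷ d ∷ e ∷ []} 1≤u u≤1+p zz avoids = record
  { 1≤a = compress-positive 1≤u 1≤a
  ; 1≤c = compress-positive 1≤u 1≤c
  ; 1≤e = compress-positive 1≤u 1≤e
  ; a<b = compress-mono-< (avoids x₁) a<b
  ; c<b = compress-mono-< (avoids x₃) c<b
  ; c<d = compress-mono-< (avoids x₃) c<d
  ; e<d = compress-mono-< (avoids x₅) e<d
  ; b≤q = compress-≤-pred u≤1+p b≤q (avoids x₂)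
  ; d≤q = compress-≤-pred u≤1+p d≤q (avoids x₄)
  }
  where open ZigZag zz

unused-label : ∀ v → ∃[ u ] 1 ≤ u × u ≤ 6 × Avoids u v
unused-label v with ¬∀⟶∃¬ 6 Used (λ k → any? λ x → lookup v x ≟ suc (toℕ k)) not-all-used
  where
  Used : Fin 6 → Set
  Used k = ∃[ x ] lookup v x ≡ suc (toℕ k)
  not-all-used : ¬ (∀ k → Used k)
  not-all-used used with pigeonhole (n<1+n 5) (proj₁ ∘ used)
  ... | i , j , i<j , same =
    <⇒≢ i<j (suc-injective (trans (sym (proj₂ (used i))) (trans (cong (lookup v) same) (proj₂ (used j)))))
... | k , unused = suc (toℕ k) , s≤s z≤n , toℕ<n k , λ x eq → unused (x , eq)

proMin-entry : ∀ v w → proMin v w ≡ v ∸ 1 ⊎ proMin v w ≡ w ∸ 1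
proMin-entry v w with v ≡ᵇ 1
... | true  = inj₂ refl
... | false = inj₁ refl

pro′-entries : ∀ q v x → lookup (pro′ q v) x ≡ q ⊎ ∃[ y ] lookup (pro′ q v) x ≡ lookup v y ∸ 1
pro′-entries q (a ∷ b ∷ c ∷ d ∷ e ∷ []) x₁ with proMin-entry a b
... | inj₁ eq = inj₂ (x₁ , eq)
... | inj₂ eq = inj₂ (x₂ , eq)
pro′-entries q (a ∷ b ∷ c ∷ d ∷ e ∷ []) x₂ with boxEnters a b c d
... | true  = inj₁ refl
... | false = inj₂ (x₂ , refl)
pro′-entries q (a ∷ b ∷ c ∷ d ∷ e ∷ []) x₃ with proMin-entry c (b ⊓ d) | ⊓-sel b d
... | inj₁ eq | _          = inj₂ (x₃ , eq)
... | inj₂ eq | inj₁ b⊓d≡b = inj₂ (x₂ , trans eq (cong (_∸ 1) b⊓d≡b))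
... | inj₂ eq | inj₂ b⊓d≡d = inj₂ (x₄ , trans eq (cong (_∸ 1) b⊓d≡d))
pro′-entries q (a ∷ b ∷ c ∷ d ∷ e ∷ []) x₄ with boxEnters e d c b
... | true  = inj₁ refl
... | false = inj₂ (x₄ , refl)
pro′-entries q (a ∷ b ∷ c ∷ d ∷ e ∷ []) x₅ with proMin-entry e d
... | inj₁ eq = inj₂ (x₅ , eq)
... | inj₂ eq = inj₂ (x₄ , eq)

pro′-avoids : ∀ {q u v} → Increasing q v → Avoids (suc u) v → u ≢ q → Avoids u (pro′ q v)
pro′-avoids {q} {u} {v} inc avoids u≢q x eq with pro′-entries q v x
... | inj₁ eq′       = u≢q (trans (sym eq) eq′)
... | inj₂ (y , eq′) = avoids y (∸1≡⇒≡suc (proj₁ (labels-bounded inc y)) (trans (sym eq′) eq))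
  where
  ∸1≡⇒≡suc : ∀ {m n} → 1 ≤ m → m ∸ 1 ≡ n → m ≡ suc n
  ∸1≡⇒≡suc {suc m} _ refl = refl

pro′-without-1 : ∀ {q v} → Avoids 1 v → pro′ q v ≡ map (_∸ 1) v
pro′-without-1 {v = a ∷ b ∷ c ∷ d ∷ e ∷ []} avoids
  rewrite ≢⇒≡ᵇ≡false (avoids x₁) | ≢⇒≡ᵇ≡false (avoids x₃) | ≢⇒≡ᵇ≡false (avoids x₅) = refl

-- v arises from the labeling w in [p] by raising every label ≥ u by one.
record Gap (p u : ℕ) (v w : Labeling) : Set where
  field
    increasing : Increasing (suc p) v
    avoids     : Avoids u v
    compresses : compressLab u v ≡ w

gap-injective : ∀ {p u v v′ w} → Gap p u v w → Gap p u v′ w → v ≡ v′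
gap-injective gap gap′ =
  compressLab-injective (Gap.avoids gap) (Gap.avoids gap′) (trans (Gap.compresses gap) (sym (Gap.compresses gap′)))

gap-top : ∀ {p v} → Increasing p v → Gap p (suc p) v v
gap-top {p} {v} inc = record
  { increasing = increasing-mono (n≤1+n p) inc
  ; avoids     = λ x → <⇒≢ (s≤s (label≤p x))
  ; compresses = Pointwise-≡⇒≡ (ext λ x → trans (lookup-map x (compress (suc p)) v) (compress-≤ (m≤n⇒m≤1+n (label≤p x))))
  }
  where
  label≤p : ∀ x → lookup v x ≤ p
  label≤p x = proj₂ (labels-bounded inc x)

gap-step : ∀ {p u v w} → 1 ≤ u → u ≤ p → Gap p (suc u) v w → Gap p u (pro′ (suc p) v) (pro′ p w)
gap-step {p} 1≤u u≤p gap = record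
  { increasing = pro′-increasing increasing
  ; avoids     = pro′-avoids increasing avoids (<⇒≢ (s≤s u≤p))
  ; compresses = trans (compress-pro′ 1≤u u≤p avoids) (cong (pro′ p) compresses)
  }
  where open Gap gap

gap-idle : ∀ {p v w} → Gap p 1 v w → Gap p (suc p) (pro′ (suc p) v) w
gap-idle {p} {v@(a ∷ b ∷ c ∷ d ∷ e ∷ [])} gap = record
  { increasing = pro′-increasing increasing
  ; avoids     = subst (Avoids (suc p)) (sym decrements) λ x →
                   subst (_≢ suc p) (sym (lookup-map x (_∸ 1) v))
                     (<⇒≢ (s≤s (∸-monoˡ-≤ 1 (proj₂ (labels-bounded increasing x)))))
  ; compresses = trans (cong (compressLab (suc p)) decrements)
                   (trans (∷₅-cong (idle x₁) (idle x₂) (idle x₃) (idle x₄) (idle x₅)) compresses)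
  }
  where
  open Gap gap
  decrements : pro′ (suc p) v ≡ map (_∸ 1) v
  decrements = pro′-without-1 avoids
  idle : ∀ x → compress (suc p) (lookup v x ∸ 1) ≡ compress 1 (lookup v x)
  idle x = trans (compress-≤ (≤-trans (m∸n≤m _ 1) (proj₂ bounds)))
                 (sym (compress-> (≤∧≢⇒< (proj₁ bounds) (avoids x ∘ sym))))
    where bounds = labels-bounded increasing x

gap-descent : ∀ n {p u v w} → 1 ≤ u → n + u ≤ suc p → Gap p (n + u) v w →
              Gap p u (iter (pro′ (suc p)) n v) (iter (pro′ p) n w)
gap-descent zero                    _   _     gap = gap
gap-descent (suc n) {p} {u} {v} {w} 1≤u bound gap =
  gap-step 1≤u (m+n≤o⇒n≤o n (≤-pred bound))
    (gap-descent n (s≤s z≤n) (subst (_≤ suc p) (sym (+-suc n u)) bound) (subst (λ k → Gap p k v w) (sym (+-suc n u)) gap))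

-- The gap descends from u to 1, jumps to p + 1 while the compression does not move,
-- and descends back to u: p + 1 steps upstairs, p downstairs.
gap-rotation : ∀ {p u v w} → 1 ≤ u → u ≤ suc p → Gap p u v w →
               Gap p u (iter (pro′ (suc p)) (suc p) v) (iter (pro′ p) p w)
gap-rotation {p} {suc u} {v} {w} _ 1+u≤1+p gap = subst₂ (Gap p (suc u)) E-steps E′-steps back-to-u
  where
  E = pro′ (suc p)
  E′ = pro′ p
  u≤p = ≤-pred 1+u≤1+p
  down-to-1 : Gap p 1 (iter E u v) (iter E′ u w)
  down-to-1 = gap-descent u ≤-refl (subst (_≤ suc p) (+-comm 1 u) 1+u≤1+p) (subst (λ k → Gap p k v w) (+-comm 1 u) gap)
  rest : (p ∸ u) + suc u ≡ suc p
  rest = trans (+-suc (p ∸ u) u) (cong suc (m∸n+n≡m u≤p))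
  back-to-u : Gap p (suc u) (iter E (p ∸ u) (iter E (suc u) v)) (iter E′ (p ∸ u) (iter E′ u w))
  back-to-u = gap-descent (p ∸ u) (s≤s z≤n) (≤-reflexive rest)
    (subst (λ k → Gap p k (iter E (suc u) v) (iter E′ u w)) (sym rest) (gap-idle down-to-1))
  E-steps : iter E (p ∸ u) (iter E (suc u) v) ≡ iter E (suc p) v
  E-steps = trans (sym (iter-+ E (p ∸ u) (suc u) v)) (cong (λ k → iter E k v) rest)
  E′-steps : iter E′ (p ∸ u) (iter E′ u w) ≡ iter E′ p w
  E′-steps = trans (sym (iter-+ E′ (p ∸ u) u w)) (cong (λ k → iter E′ k w) (m∸n+n≡m u≤p))

gap-rotations : ∀ N {p u v w} → 1 ≤ u → u ≤ suc p → Gap p u v w →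
                Gap p u (iter (pro′ (suc p)) (N * suc p) v) (iter (pro′ p) (N * p) w)
gap-rotations zero                    _   _     gap = gap
gap-rotations (suc N) {p} {u} {v} {w} 1≤u u≤1+p gap =
  subst₂ (Gap p u) (sym (iter-+ (pro′ (suc p)) (suc p) (N * suc p) v)) (sym (iter-+ (pro′ p) p (N * p) w))
    (gap-rotation 1≤u u≤1+p (gap-rotations N 1≤u u≤1+p gap))

gap-periodic : ∀ N {p u v w} → 1 ≤ u → u ≤ suc p → Gap p u v w →
               iter (pro′ (suc p)) (N * suc p) v ≡ v ⇔ iter (pro′ p) (N * p) w ≡ w
gap-periodic N {u = u} 1≤u u≤1+p gap = mk⇔
  (λ fixed → trans (sym (Gap.compresses rotated)) (trans (cong (compressLab u) fixed) (Gap.compresses gap)))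
  (λ fixed → gap-injective (subst (Gap _ u _) fixed rotated) gap)
  where rotated = gap-rotations N 1≤u u≤1+p gap

lift-periodic : ∀ N {m q v} → m ≤′ q → Increasing m v → iter (pro′ q) (N * q) v ≡ v ⇔ iter (pro′ m) (N * m) v ≡ v
lift-periodic N ≤′-refl        inc = ⇔.refl
lift-periodic N (≤′-step m≤′p) inc =
  ⇔.trans (gap-periodic N (s≤s z≤n) ≤-refl (gap-top (increasing-mono (≤′⇒≤ m≤′p) inc))) (lift-periodic N m≤′p inc)

avoids⇒moved : ∀ {p u v} s x → Increasing (suc p) v → Avoids (s + u) v → 1 ≤ u → s + u ≤ suc p →
               lookup v x ≡ u → iter (pro′ (suc p)) s v ≢ v
avoids⇒moved s x inc avoids 1≤u bound vₓ≡u fixed =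
  Gap.avoids (gap-descent s 1≤u bound (record { increasing = inc ; avoids = avoids ; compresses = refl })) x
    (trans (cong (λ w → lookup w x) fixed) vₓ≡u)

-- The case q = 5, by evaluation

-- Forcing the entries makes the type checker share them between steps instead of copying
-- unevaluated terms, which would grow exponentially with the number of steps.
forceLabeling : Labeling → Labeling
forceLabeling (a ∷ b ∷ c ∷ d ∷ e ∷ []) =
  force a λ a → force b λ b → force c λ c → force d λ d → force e λ e → a ∷ b ∷ c ∷ d ∷ e ∷ []

forceLabeling-≡ : ∀ v → forceLabeling v ≡ v
forceLabeling-≡ (a ∷ b ∷ c ∷ d ∷ e ∷ []) =
  trans (force-≡ a _) (trans (force-≡ b _) (trans (force-≡ c _) (trans (force-≡ d _) (force-≡ e _))))

iterStrict : (Labeling → Labeling) → ℕ → Labeling → Labeling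
iterStrict f zero    v = v
iterStrict f (suc n) v = iterStrict f n (forceLabeling (f v))

iterStrict≡iter : ∀ f n v → iterStrict f n v ≡ iter f n v
iterStrict≡iter f zero    v = refl
iterStrict≡iter f (suc n) v =
  trans (iterStrict≡iter f n _) (trans (cong (iter f n) (forceLabeling-≡ (f v))) (iter-suc f n v))

_≟ₗ_ : (v w : Labeling) → Dec (v ≡ w)
_≟ₗ_ = ≡-dec _≟_

fixedBy₅ : ℕ → Labeling → Bool
fixedBy₅ n v = isYes (iterStrict (pro′ 5) n v ≟ₗ v)

fixedBy₅-sound : ∀ n v → T (fixedBy₅ n v) → iter (pro′ 5) n v ≡ v
fixedBy₅-sound n v fixed = trans (sym (iterStrict≡iter (pro′ 5) n v)) (toWitness {a? = iterStrict (pro′ 5) n v ≟ₗ v} fixed)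

movedBy₅-sound : ∀ n v → T (not (fixedBy₅ n v)) → iter (pro′ 5) n v ≢ v
movedBy₅-sound n v moved = toWitnessFalse {a? = iterStrict (pro′ 5) n v ≟ₗ v} moved ∘ trans (iterStrict≡iter (pro′ 5) n v)

All≤ : ℕ → (ℕ → Set) → Set
All≤ n P = ∀ {k} → 1 ≤ k → k ≤ n → P k

all≤? : ∀ n {P : ℕ → Set} → (∀ k → Dec (P k)) → Dec (All≤ n P)
all≤? zero    P? = yes λ 1≤k k≤0 → contradiction (≤-trans 1≤k k≤0) λ ()
all≤? (suc n) P? = map′
  (λ (p , all) {k} 1≤k k≤1+n → [ (λ k<1+n → all 1≤k (≤-pred k<1+n)) , (λ { refl → p }) ]′ (m≤n⇒m<n∨m≡n k≤1+n))
  (λ all → all (s≤s z≤n) ≤-refl , λ {k} 1≤k k≤n → all 1≤k (m≤n⇒m≤1+n k≤n))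
  (P? (suc n) ×-dec all≤? n P?)

-- Every orbit for q = 5 has length 4, 5, 10, 12, 25 or 40.
Returns₅ : Labeling → Set
Returns₅ v = T (fixedBy₅ 40 v) ⊎ T (fixedBy₅ 12 v) ⊎ T (fixedBy₅ 25 v)

returns₅⇒periodic : ∀ v → Returns₅ v → iter (pro′ 5) (120 * 5) v ≡ v
returns₅⇒periodic v (inj₁ by40)        = iter-* (pro′ 5) {40} (fixedBy₅-sound 40 v by40) 15
returns₅⇒periodic v (inj₂ (inj₁ by12)) = iter-* (pro′ 5) {12} (fixedBy₅-sound 12 v by12) 50
returns₅⇒periodic v (inj₂ (inj₂ by25)) = iter-* (pro′ 5) {25} (fixedBy₅-sound 25 v by25) 24

all-return₅ : All≤ 5 λ b → All≤ 5 λ d → All≤ (pred b) λ a → All≤ (pred (b ⊓ d)) λ c → All≤ (pred d) λ e →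
                Returns₅ (a ∷ b ∷ c ∷ d ∷ e ∷ [])
all-return₅ = toWitness {a? = all≤? 5 λ b → all≤? 5 λ d → all≤? (pred b) λ a → all≤? (pred (b ⊓ d)) λ c →
                                all≤? (pred d) λ e → returns₅? (a ∷ b ∷ c ∷ d ∷ e ∷ [])} tt
  where
  returns₅? : ∀ v → Dec (Returns₅ v)
  returns₅? v = T? (fixedBy₅ 40 v) ⊎-dec T? (fixedBy₅ 12 v) ⊎-dec T? (fixedBy₅ 25 v)

pro′₅-period : ∀ {v} → Increasing 5 v → iter (pro′ 5) (120 * 5) v ≡ v
pro′₅-period {v@(a ∷ b ∷ c ∷ d ∷ e ∷ [])} zz = returns₅⇒periodic v
  (all-return₅ (≤-trans 1≤a (<⇒≤ a<b)) b≤q (≤-trans 1≤e (<⇒≤ e<d)) d≤q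
     1≤a (<⇒≤pred a<b) 1≤c (<⇒≤pred (⊓-glb c<b c<d)) 1≤e (<⇒≤pred e<d))
  where open ZigZag zz

exact-period₅ : ∀ d v .{{_ : NonZero d}} → T (fixedBy₅ d v) → True (all≤? (pred d) λ s → T? (not (fixedBy₅ s v))) →
                ∀ {m} → iter (pro′ 5) m v ≡ v → d ∣ m
exact-period₅ d v returns moves = period-∣ (pro′ 5) (fixedBy₅-sound d v returns)
  λ s 1≤s s<d → movedBy₅-sound s v (toWitness moves 1≤s (<⇒≤pred s<d))

f₀ g₄₀ g₁₂ g₂₅ : Labeling
f₀  = 1 ∷ 2 ∷ 1 ∷ 2 ∷ 1 ∷ []
g₄₀ = 1 ∷ 2 ∷ 1 ∷ 3 ∷ 1 ∷ []
g₁₂ = 1 ∷ 3 ∷ 2 ∷ 5 ∷ 4 ∷ []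
g₂₅ = 1 ∷ 2 ∷ 1 ∷ 4 ∷ 3 ∷ []

f₀-increasing : Increasing 2 f₀
f₀-increasing = zigzag ≤-literal ≤-literal ≤-literal ≤-literal ≤-literal ≤-literal ≤-literal ≤-literal ≤-literal

witnesses : Vec Labeling 4
witnesses = f₀ ∷ g₄₀ ∷ g₁₂ ∷ g₂₅ ∷ []

witnesses-increasing : ∀ i → Increasing 5 (lookup witnesses i)
witnesses-increasing zero                   = increasing-mono ≤-literal f₀-increasing
witnesses-increasing (suc zero)             = zigzag ≤-literal ≤-literal ≤-literal ≤-literal ≤-literal ≤-literal ≤-literal ≤-literal ≤-literal
witnesses-increasing (suc (suc zero))       = zigzag ≤-literal ≤-literal ≤-literal ≤-literal ≤-literal ≤-literal ≤-literal ≤-literal ≤-literal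
witnesses-increasing (suc (suc (suc zero))) = zigzag ≤-literal ≤-literal ≤-literal ≤-literal ≤-literal ≤-literal ≤-literal ≤-literal ≤-literal

g₄₀-period : ∀ {m} → iter (pro′ 5) m g₄₀ ≡ g₄₀ → 40 ∣ m
g₄₀-period = exact-period₅ 40 g₄₀ tt tt

g₁₂-period : ∀ {m} → iter (pro′ 5) m g₁₂ ≡ g₁₂ → 12 ∣ m
g₁₂-period = exact-period₅ 12 g₁₂ tt tt

g₂₅-period : ∀ {m} → iter (pro′ 5) m g₂₅ ≡ g₂₅ → 25 ∣ m
g₂₅-period = exact-period₅ 25 g₂₅ tt tt

-- The order of promotion

pro′-period : ∀ {q v} → 5 ≤′ q → Increasing q v → iter (pro′ q) (120 * q) v ≡ v
pro′-period {v = v} ≤′-refl inc = pro′₅-period {v} inc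
pro′-period {suc p} {v} (≤′-step 5≤′p) inc with unused-label v
... | u , 1≤u , u≤6 , avoids =
  Equivalence.from (gap-periodic 120 1≤u u≤1+p gap) (pro′-period 5≤′p (compressLab-increasing 1≤u u≤1+p inc avoids))
  where
  u≤1+p : u ≤ suc p
  u≤1+p = ≤-trans u≤6 (s≤s (≤′⇒≤ 5≤′p))
  gap : Gap p u v (compressLab u v)
  gap = record { increasing = inc ; avoids = avoids ; compresses = refl }

f₀-avoids : ∀ {n} → 2 < n → Avoids n f₀
f₀-avoids 2<n x eq = <⇒≱ 2<n (subst (_≤ 2) eq (proj₂ (labels-bounded f₀-increasing x)))

f₀-moves : ∀ {q} → 3 ≤ q → ∀ s → 1 ≤ s → s < q → iter (pro′ q) s f₀ ≢ f₀
f₀-moves {suc p} 3≤q (suc zero) _ _ =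
  avoids⇒moved {u = 2} 1 x₂ (increasing-mono (≤-trans (n≤1+n 2) 3≤q) f₀-increasing) (f₀-avoids ≤-refl) (s≤s z≤n) 3≤q refl
f₀-moves {suc p} 3≤q (suc (suc s)) _ s<q =
  avoids⇒moved {u = 1} (suc (suc s)) x₁ (increasing-mono (≤-trans (n≤1+n 2) 3≤q) f₀-increasing)
    (f₀-avoids (s≤s (s≤s (m≤n+m 1 s)))) ≤-refl (subst (_≤ suc p) (+-comm 1 (suc (suc s))) s<q) refl

f₀-period : ∀ {q} → 5 ≤′ q → ∀ {m} → iter (pro′ q) m f₀ ≡ f₀ → q ∣ m
f₀-period {q} 5≤′q = period-∣ (pro′ q) ⦃ >-nonZero (≤-trans ≤-literal 5≤q) ⦄ returns (f₀-moves (≤-trans ≤-literal 5≤q))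
  where
  5≤q = ≤′⇒≤ 5≤′q
  returns : iter (pro′ q) q f₀ ≡ f₀
  returns = subst (λ n → iter (pro′ q) n f₀ ≡ f₀) (*-identityˡ q)
    (Equivalence.from (lift-periodic 1 5≤′q (witnesses-increasing zero)) (fixedBy₅-sound 5 f₀ tt))

no-smaller-period : ∀ {q M} → 5 ≤′ q → 1 ≤ M → M < 120 * q →
                    ¬ (∀ i → iter (pro′ q) M (lookup witnesses i) ≡ lookup witnesses i)
no-smaller-period {q} {M} 5≤′q 1≤M M<120q fixed with f₀-period 5≤′q (fixed zero)
... | divides j M≡j*q = <⇒≱ M<120q (∣⇒≤ ⦃ >-nonZero 1≤M ⦄ 120q∣M)
  where
  fixed₅ : ∀ i → iter (pro′ 5) (j * 5) (lookup witnesses i) ≡ lookup witnesses i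
  fixed₅ i = Equivalence.to (lift-periodic j 5≤′q (witnesses-increasing i))
    (subst (λ n → iter (pro′ q) n (lookup witnesses i) ≡ lookup witnesses i) M≡j*q (fixed i))
  600∣5j : lcm (lcm 40 12) 25 ∣ j * 5
  600∣5j = lcm-least (lcm-least (g₄₀-period {j * 5} (fixed₅ (suc zero))) (g₁₂-period {j * 5} (fixed₅ (suc (suc zero)))))
                     (g₂₅-period {j * 5} (fixed₅ (suc (suc (suc zero)))))
  120q∣M : 120 * q ∣ M
  120q∣M = subst (120 * q ∣_) (sym M≡j*q) (*-monoˡ-∣ {m = 120} {n = j} q (*-cancelʳ-∣ 5 600∣5j))

minimal : ∀ {q} → 5 ≤′ q → ∀ M → 1 ≤ M → M < 120 * q → Σ Labeling λ f → IncLab q f × iter (pro q) M f ≢ f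
minimal {q} 5≤′q M 1≤M M<120q = lookup witnesses (proj₁ moved) , Increasing⇒IncLab (increasing (proj₁ moved)) , proj₂ moved
  where
  Fixed : Fin 4 → Set
  Fixed i = iter (pro q) M (lookup witnesses i) ≡ lookup witnesses i
  increasing : ∀ i → Increasing q (lookup witnesses i)
  increasing i = increasing-mono (≤′⇒≤ 5≤′q) (witnesses-increasing i)
  via-pro′ : (∀ i → Fixed i) → ∀ i → iter (pro′ q) M (lookup witnesses i) ≡ lookup witnesses i
  via-pro′ fixed i = trans (sym (iter-pro≡iter-pro′ (increasing i) M)) (fixed i)
  moved : ∃[ i ] ¬ Fixed i
  moved = ¬∀⟶∃¬ 4 Fixed (λ i → iter (pro q) M (lookup witnesses i) ≟ₗ lookup witnesses i)
            (no-smaller-period 5≤′q 1≤M M<120q ∘ via-pro′)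

corollary4p4 : (q : ℕ) → 5 ≤ q → IsPromotionOrder q (120 * q)
corollary4p4 q 5≤q = ≤-trans (≤-trans ≤-literal 5≤q) (m≤n*m q 120) , periodic , minimal (≤⇒≤′ 5≤q)
  where
  periodic : ∀ f → IncLab q f → iter (pro q) (120 * q) f ≡ f
  periodic f incLab = trans (iter-pro≡iter-pro′ inc (120 * q)) (pro′-period (≤⇒≤′ 5≤q) inc)
    where inc = IncLab⇒Increasing incLab
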